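{- For $n\ge1$, the elements $\{1,2,\ldots,n-1\}$ and $\{2,3,\ldots,n\}$ are left-modular in $L_n$, the lattice of arithmetic progressions in $[n]$.
   Context: $L_n$ is the set of all subsets of $[n]=\{1,\ldots,n\}$ that are arithmetic progressions $\{a,a+r,\ldots,a+(k-1)r\}$ ($a$, $r\ge1$, $k\ge0$ integers; including $\emptyset$, singletons and $2$-element subsets), ordered by inclusion; it is a lattice with meet $\wedge$ given by intersection and join $\vee$ given by the smallest progression containing both. An element $m$ of a lattice $L$ is left-modular in $L$ if for all $x<y$ in $L$, $(x\vee m)\wedge y=x\vee(m\wedge y)$. -}

module Defs where

open import Data.Nat using (ℕ; zero; suc; _+_; _*_; _≤_; _<_; _<ᵇ_)
open import Data.Fin using (Fin; toℕ)
open import Data.Fin.Subset using (Subset; _∈_; _⊆_; _⊂_; _∩_)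
open import Data.Vec using (tabulate)
open import Data.Product using (Σ; ∃; _×_)
open import Relation.Binary.PropositionalEquality using (_≡_)
open import Function.Bundles using (_⇔_)

-- Convention: element i : Fin n of a subset represents the number toℕ i + 1 ∈ [n] = {1,…,n}.

IsAP : (n : ℕ) → Subset n → Set
IsAP n S =
  Σ ℕ λ a → Σ ℕ λ r → Σ ℕ λ k →
    (1 ≤ a) × (1 ≤ r) ×
    (∀ j → j < k → a + j * r ≤ n) ×
    (∀ (i : Fin n) → (i ∈ S) ⇔ (∃ λ j → j < k × suc (toℕ i) ≡ a + j * r))

IsJoin : (n : ℕ) → Subset n → Subset n → Subset n → Set
IsJoin n x y j =
  IsAP n j × x ⊆ j × y ⊆ j ×
  (∀ z → IsAP n z → x ⊆ z → y ⊆ z → j ⊆ z)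

-- m is left-modular in L_n: m ∈ L_n and for all x < y in L_n,
-- (x ∨ m) ∧ y = x ∨ (m ∧ y), where meet is intersection and joins are as above.
LeftModular : (n : ℕ) → Subset n → Set
LeftModular n m =
  IsAP n m ×
  (∀ x y → IsAP n x → IsAP n y → x ⊂ y →
     ∀ j k → IsJoin n x m j → IsJoin n x (m ∩ y) k →
     j ∩ y ≡ k)

initialSeg : (n : ℕ) → Subset n
initialSeg n = tabulate (λ (i : Fin n) → suc (toℕ i) <ᵇ n)

finalSeg : (n : ℕ) → Subset n
finalSeg n = tabulate (λ (i : Fin n) → 1 <ᵇ suc (toℕ i))

{-# OPTIONS --safe #-}
module Submission where

open import Defs
open import Data.Nat using (ℕ; zero; suc; _+_; _*_; _≤_; _<_; z≤n; s≤s; s≤s⁻¹)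
open import Data.Nat.Properties
open import Data.Fin using (Fin; toℕ; fromℕ)
open import Data.Fin.Properties using (toℕ<n; toℕ-injective; toℕ-fromℕ)
import Data.Fin as Fin
open import Data.Fin.Subset using (Subset; _∈_; _⊆_; _⊂_; _∩_)
open import Data.Fin.Subset.Properties using (⊆-antisym; ⊆-trans; p∩q⊆p; p∩q⊆q; x∈p∩q⁺; x∈p∩q⁻; _∈?_)
open import Data.Vec using (tabulate)
open import Data.Vec.Properties using (lookup∘tabulate; []=⇒lookup; lookup⇒[]=)
open import Data.Bool using (Bool; T)
open import Data.Bool.Properties using (T-≡)
open import Data.Product using (∃; ∃₂; _×_; _,_; proj₁)
open import Data.Empty using (⊥-elim)
open import Relation.Nullary using (yes; no; contradiction)
open import Relation.Binary.PropositionalEquality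
open import Function using (_∘_)
open import Function.Bundles using (_⇔_; mk⇔; Equivalence)
open Equivalence

-- Both segments miss exactly one point p of [n] and meet every progression in a
-- progression. For such an m, if p ∈ x then x ∨ m and x ∨ (m ∧ y) both contain all of
-- y, so both sides equal y; if p ∉ x then x ≤ m, so x ∨ m = m and x ∨ (m ∧ y) = m ∧ y.
-- That m ∧ y is a progression holds because the terms of y lying in m form a window
-- of consecutive indices: the segments can only cut off the last, resp. first, term.

∈-tabulate⇔ : ∀ {n} (f : Fin n → Bool) (i : Fin n) → i ∈ tabulate f ⇔ T (f i)
∈-tabulate⇔ f i = mk⇔
  (λ i∈ → from T-≡ (trans (sym (lookup∘tabulate f i)) ([]=⇒lookup i∈)))
  (λ fi → lookup⇒[]= i (tabulate f) (trans (lookup∘tabulate f i) (to T-≡ fi)))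

∈-initialSeg⇔ : ∀ {n} (i : Fin n) → i ∈ initialSeg n ⇔ suc (toℕ i) < n
∈-initialSeg⇔ {n} i = mk⇔
  (<ᵇ⇒< _ n ∘ to (∈-tabulate⇔ _ i)) (from (∈-tabulate⇔ _ i) ∘ <⇒<ᵇ)

∈-finalSeg⇔ : ∀ {n} (i : Fin n) → i ∈ finalSeg n ⇔ 1 < suc (toℕ i)
∈-finalSeg⇔ i = mk⇔
  (<ᵇ⇒< 1 _ ∘ to (∈-tabulate⇔ _ i)) (from (∈-tabulate⇔ _ i) ∘ <⇒<ᵇ)

join-absorbs : ∀ {n} {x m j : Subset n} → IsAP n m → x ⊆ m → IsJoin n x m j → j ≡ m
join-absorbs {m = m} m-AP x⊆m (_ , _ , m⊆j , least) =
  ⊆-antisym (least m m-AP x⊆m (λ i∈m → i∈m)) m⊆j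

leftModular-if-misses-one : ∀ {n} (m : Subset n) (p : Fin n) → IsAP n m →
  (∀ i → i ≢ p → i ∈ m) → (∀ y → IsAP n y → IsAP n (m ∩ y)) → LeftModular n m
leftModular-if-misses-one {n} m p m-AP misses-p ∩-AP = m-AP , modular
  where
  modular : ∀ x y → IsAP n x → IsAP n y → x ⊂ y →
    ∀ j k → IsJoin n x m j → IsJoin n x (m ∩ y) k → j ∩ y ≡ k
  modular x y _ y-AP (x⊆y , _) j k j-join@(_ , x⊆j , m⊆j , _) k-join@(_ , x⊆k , m∩y⊆k , k-least)
    with p ∈? x
  ... | yes p∈x = trans j∩y≡y (sym k≡y)
    where
    fills : ∀ {z} → p ∈ z → m ∩ y ⊆ z → y ⊆ z
    fills p∈z m∩y⊆z {i} i∈y with i Fin.≟ p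
    ... | yes refl = p∈z
    ... | no i≢p = m∩y⊆z (x∈p∩q⁺ (misses-p i i≢p , i∈y))
    j∩y≡y : j ∩ y ≡ y
    j∩y≡y = ⊆-antisym (p∩q⊆q j y)
      (λ i∈y → x∈p∩q⁺ (fills (x⊆j p∈x) (⊆-trans (p∩q⊆p m y) m⊆j) i∈y , i∈y))
    k≡y : k ≡ y
    k≡y = ⊆-antisym (k-least y y-AP x⊆y (p∩q⊆q m y)) (fills (x⊆k p∈x) m∩y⊆k)
  ... | no p∉x = begin
      j ∩ y  ≡⟨ cong (_∩ y) (join-absorbs m-AP x⊆m j-join) ⟩
      m ∩ y  ≡⟨ sym (join-absorbs (∩-AP y y-AP) (λ i∈x → x∈p∩q⁺ (x⊆m i∈x , x⊆y i∈x)) k-join) ⟩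
      k      ∎
    where
    open ≡-Reasoning
    x⊆m : x ⊆ m
    x⊆m {i} i∈x with i Fin.≟ p
    ... | yes refl = contradiction i∈x p∉x
    ... | no i≢p = misses-p i i≢p

Window : (ℕ → Set) → ℕ → ℕ → ℕ → Set
Window Q a r k = ∃₂ λ lo c → ∀ j → (j < k × Q (a + j * r)) ⇔ (lo ≤ j × j < lo + c)

empty-window : ∀ Q a r → Window Q a r 0
empty-window _ _ _ = 0 , 0 , λ j → mk⇔ (λ { (() , _) }) (λ { (_ , ()) })

term-<-mono : ∀ a {r j k} → 1 ≤ r → j < k → a + j * r < a + k * r
term-<-mono a {suc _} _ j<k = +-monoʳ-< a (*-monoˡ-< _ j<k)

∩-isAP : ∀ {n} (m : Subset n) (Q : ℕ → Set) → (∀ i → i ∈ m ⇔ Q (suc (toℕ i))) →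
  (∀ a r k → 1 ≤ a → 1 ≤ r → (∀ j → j < k → a + j * r ≤ n) → Window Q a r k) →
  ∀ y → IsAP n y → IsAP n (m ∩ y)
∩-isAP {n} m Q m⇔Q window y (a , r , k , 1≤a , 1≤r , bounded , y⇔)
  with window a r k 1≤a 1≤r bounded
... | lo , c , win = a + lo * r , r , c , ≤-trans 1≤a (m≤m+n a (lo * r)) , 1≤r , bounded′ , m∩y⇔
  where
  shift : ∀ j → a + (lo + j) * r ≡ a + lo * r + j * r
  shift j = begin
    a + (lo + j) * r       ≡⟨ cong (a +_) (*-distribʳ-+ r lo j) ⟩
    a + (lo * r + j * r)   ≡⟨ sym (+-assoc a (lo * r) (j * r)) ⟩
    a + lo * r + j * r     ∎
    where open ≡-Reasoning
  in-window : ∀ {o} → o < c → lo + o < k × Q (a + (lo + o) * r)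
  in-window {o} o<c = from (win (lo + o)) (m≤m+n lo o , +-monoʳ-< lo o<c)
  bounded′ : ∀ o → o < c → a + lo * r + o * r ≤ n
  bounded′ o o<c = subst (_≤ n) (shift o) (bounded (lo + o) (proj₁ (in-window o<c)))
  m∩y⇔ : ∀ i → i ∈ m ∩ y ⇔ ∃ λ o → o < c × suc (toℕ i) ≡ a + lo * r + o * r
  m∩y⇔ i = mk⇔ forward backward
    where
    forward : i ∈ m ∩ y → ∃ λ o → o < c × suc (toℕ i) ≡ a + lo * r + o * r
    forward i∈m∩y with x∈p∩q⁻ m y i∈m∩y
    ... | i∈m , i∈y with to (y⇔ i) i∈y
    ... | j , j<k , i≡term with to (win j) (j<k , subst Q i≡term (to (m⇔Q i) i∈m))
    ... | lo≤j , j<lo+c with m≤n⇒∃[o]m+o≡n lo≤j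
    ... | o , refl = o , +-cancelˡ-< lo o c j<lo+c , trans i≡term (shift o)
    backward : (∃ λ o → o < c × suc (toℕ i) ≡ a + lo * r + o * r) → i ∈ m ∩ y
    backward (o , o<c , i≡term) with in-window o<c | trans i≡term (sym (shift o))
    ... | lo+o<k , Q-term | i≡term′ = x∈p∩q⁺
      ( from (m⇔Q i) (subst Q (sym i≡term′) Q-term)
      , from (y⇔ i) (lo + o , lo+o<k , i≡term′))

initial-window : ∀ {n} a r k → 1 ≤ r → (∀ j → j < k → a + j * r ≤ n) → Window (_< n) a r k
initial-window {n} a r zero _ _ = empty-window (_< n) a r
initial-window {n} a r (suc k) 1≤r bounded with a + k * r ≟ n
... | no last≢n = 0 , suc k , λ j → mk⇔
  (λ (j<k , _) → z≤n , j<k)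
  (λ (_ , j<k) → j<k , ≤-<-trans (+-monoʳ-≤ a (*-monoˡ-≤ r (s≤s⁻¹ j<k)))
                                  (≤∧≢⇒< (bounded k ≤-refl) last≢n))
... | yes last≡n = 0 , k , λ j → mk⇔
  (λ (j<1+k , term<n) → z≤n , ≤∧≢⇒< (s≤s⁻¹ j<1+k) λ { refl → <-irrefl last≡n term<n })
  (λ (_ , j<k) → m<n⇒m<1+n j<k , subst (_ <_) last≡n (term-<-mono a 1≤r j<k))

final-window : ∀ a r k → 1 ≤ a → 1 ≤ r → Window (1 <_) a r k
final-window a r zero _ _ = empty-window (1 <_) a r
final-window a r (suc k) 1≤a 1≤r with a ≟ 1
... | no a≢1 = 0 , suc k , λ j → mk⇔
  (λ (j<k , _) → z≤n , j<k)
  (λ (_ , j<k) → j<k , <-≤-trans (≤∧≢⇒< 1≤a (a≢1 ∘ sym)) (m≤m+n a (j * r)))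
... | yes refl = 1 , k , λ j → mk⇔ forward
  (λ { (s≤s z≤n , j<1+k) → j<1+k , s≤s (≤-trans 1≤r (m≤m+n r _)) })
  where
  forward : ∀ {j} → j < suc k × 1 < 1 + j * r → 1 ≤ j × j < 1 + k
  forward {zero} (_ , 1<1) = ⊥-elim (<-irrefl refl 1<1)
  forward {suc j} (j<1+k , _) = s≤s z≤n , j<1+k

initialSeg-isAP : ∀ n → IsAP (suc n) (initialSeg (suc n))
initialSeg-isAP n = 1 , 1 , n , s≤s z≤n , s≤s z≤n ,
  (λ j j<n → s≤s (subst (_≤ n) (sym (*-identityʳ j)) (<⇒≤ j<n))) ,
  λ i → mk⇔
    (λ i∈ → toℕ i , s≤s⁻¹ (to (∈-initialSeg⇔ i) i∈) , cong suc (sym (*-identityʳ (toℕ i))))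
    (λ (j , j<n , i≡term) → from (∈-initialSeg⇔ i)
      (subst (_< suc n) (sym i≡term) (s≤s (subst (_< n) (sym (*-identityʳ j)) j<n))))

finalSeg-isAP : ∀ n → IsAP (suc n) (finalSeg (suc n))
finalSeg-isAP n = 2 , 1 , n , s≤s z≤n , s≤s z≤n ,
  (λ j j<n → s≤s (subst (_≤ n) (sym (cong suc (*-identityʳ j))) j<n)) ,
  λ i → mk⇔ (forward i)
    (λ (j , _ , i≡term) → from (∈-finalSeg⇔ i) (subst (1 <_) (sym i≡term) (s≤s (s≤s z≤n))))
  where
  forward : ∀ i → i ∈ finalSeg (suc n) → ∃ λ j → j < n × suc (toℕ i) ≡ 2 + j * 1
  forward Fin.zero i∈ = ⊥-elim (<-irrefl refl (to (∈-finalSeg⇔ Fin.zero) i∈))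
  forward (Fin.suc i) _ = toℕ i , toℕ<n i , cong (suc ∘ suc) (sym (*-identityʳ (toℕ i)))

i≢last⇒i∈initialSeg : ∀ n (i : Fin (suc n)) → i ≢ fromℕ n → i ∈ initialSeg (suc n)
i≢last⇒i∈initialSeg n i i≢last = from (∈-initialSeg⇔ i) (s≤s (≤∧≢⇒< (s≤s⁻¹ (toℕ<n i))
  (λ i≡n → i≢last (toℕ-injective (trans i≡n (sym (toℕ-fromℕ n)))))))

i≢0⇒i∈finalSeg : ∀ n (i : Fin (suc n)) → i ≢ Fin.zero → i ∈ finalSeg (suc n)
i≢0⇒i∈finalSeg n Fin.zero i≢0 = ⊥-elim (i≢0 refl)
i≢0⇒i∈finalSeg n (Fin.suc i) _ = from (∈-finalSeg⇔ (Fin.suc i)) (s≤s (s≤s z≤n))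

initialSeg-∩-isAP : ∀ n y → IsAP n y → IsAP n (initialSeg n ∩ y)
initialSeg-∩-isAP n = ∩-isAP (initialSeg n) (_< n) ∈-initialSeg⇔ (λ a r k _ → initial-window a r k)

finalSeg-∩-isAP : ∀ n y → IsAP n y → IsAP n (finalSeg n ∩ y)
finalSeg-∩-isAP n = ∩-isAP (finalSeg n) (1 <_) ∈-finalSeg⇔ (λ a r k 1≤a 1≤r _ → final-window a r k 1≤a 1≤r)

lemma10 : (n : ℕ) → 1 ≤ n → LeftModular n (initialSeg n) × LeftModular n (finalSeg n)
lemma10 zero ()
lemma10 (suc n) _ =
  leftModular-if-misses-one (initialSeg (suc n)) (fromℕ n) (initialSeg-isAP n)
    (i≢last⇒i∈initialSeg n) (initialSeg-∩-isAP (suc n)) ,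
  leftModular-if-misses-one (finalSeg (suc n)) Fin.zero (finalSeg-isAP n)
    (i≢0⇒i∈finalSeg n) (finalSeg-∩-isAP (suc n))
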